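{- Let $A$ be a positive integer which is a palindrome and such that $(A,A)$ is a polynomial pair. Then $A^{2}$ is a palindrome.
   Context: For a positive integer $A$ with decimal representation $A=\sum_{i=0}^{a} a_i 10^i$ (digits $a_i\in\{0,\dots,9\}$, $a_a\neq0$), let $P(A,x)=\sum_{i=0}^a a_ix^i$ and let $A^{*}=\sum_{i=0}^a a_i10^{a-i}$ be its reversal; $A$ is a palindrome if $A=A^{*}$. A pair $(A,B)$ of positive integers is a polynomial pair if $P(A,x)P(B,x)=P(A\times B,x)$. -}

module Defs where

open import Data.Nat using (ℕ; zero; suc; _+_; _*_; _/_; _%_)
open import Data.List using (List; []; _∷_; reverse; map)
open import Relation.Binary.PropositionalEquality using (_≡_)

-- Decimal digits, least significant first; the fuel argument bounds the
-- number of steps (fuel n suffices for n since n / 10 < n when n > 0).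
digitsAux : ℕ → ℕ → List ℕ
digitsAux zero       _       = []
digitsAux (suc fuel) zero    = []
digitsAux (suc fuel) (suc n) = (suc n % 10) ∷ digitsAux fuel (suc n / 10)

-- digits A = [a_0, a_1, ..., a_a]  (empty for 0; leading digit a_a ≠ 0)
digits : ℕ → List ℕ
digits n = digitsAux n n

fromDigits : List ℕ → ℕ
fromDigits []       = 0
fromDigits (d ∷ ds) = d + 10 * fromDigits ds

rev : ℕ → ℕ
rev A = fromDigits (reverse (digits A))

Palindrome : ℕ → Set
Palindrome A = A ≡ rev A

-- Polynomials with ℕ coefficients as coefficient lists (constant term first).
-- P(A,x) is represented by its coefficient list digits A.
Poly : Set
Poly = List ℕ

_⊕_ : Poly → Poly → Poly
[]       ⊕ q        = q
(a ∷ p)  ⊕ []       = a ∷ p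
(a ∷ p)  ⊕ (b ∷ q)  = (a + b) ∷ (p ⊕ q)

_⊛_ : Poly → Poly → Poly
[]      ⊛ q = []
(a ∷ p) ⊛ q = map (a *_) q ⊕ (0 ∷ (p ⊛ q))

P : ℕ → Poly
P A = digits A

-- For positive A, B both sides have nonzero leading coefficient (products of
-- nonzero leading digits), so equality of coefficient lists is equality of
-- polynomials.
PolynomialPair : ℕ → ℕ → Set
PolynomialPair A B = P A ⊛ P B ≡ P (A * B)

module Submission where

-- Write N p for the number whose decimal digits, read from the
-- most significant end, are the entries of the list p; thus N p evaluates the
-- reversed coefficient list at 10, and rev A is by definition N (P A).  The
-- map N is multiplicative on the polynomial product of nonempty coefficient
-- lists (evaluating x^deg · f(1/x) at 10 is multiplicative, since degrees
-- add).  Hence, for a palindrome A with (A,A) a polynomial pair,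
--   rev (A * A) = N (P A ⊛ P A) = N (P A) * N (P A) = rev A * rev A = A * A.

open import Defs
open import Data.Nat using (ℕ; zero; suc; _+_; _*_; _^_; _⊔_; _>_; _%_; _/_; s≤s; z≤n)
open import Data.Nat.Properties
open import Data.List using (List; []; _∷_; reverse; map; length; _++_)
open import Data.List.Properties using (length-map; length-reverse; reverse-map; unfold-reverse)
open import Relation.Binary.PropositionalEquality
open import Data.Nat.Solver using (module +-*-Solver)
open +-*-Solver
open ≡-Reasoning

N : List ℕ → ℕ
N p = fromDigits (reverse p)

fromDigits-++ : ∀ xs ys → fromDigits (xs ++ ys) ≡ fromDigits xs + 10 ^ length xs * fromDigits ys
fromDigits-++ []       ys = sym (+-identityʳ (fromDigits ys))
fromDigits-++ (x ∷ xs) ys rewrite fromDigits-++ xs ys =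
  solve 4 (λ x a t b → x :+ con 10 :* (a :+ t :* b) := (x :+ con 10 :* a) :+ (con 10 :* t) :* b)
        refl x (fromDigits xs) (10 ^ length xs) (fromDigits ys)

N-cons : ∀ a p → N (a ∷ p) ≡ a * 10 ^ length p + N p
N-cons a p = begin
  fromDigits (reverse (a ∷ p))                 ≡⟨ cong fromDigits (unfold-reverse a p) ⟩
  fromDigits (reverse p ++ a ∷ [])             ≡⟨ fromDigits-++ (reverse p) (a ∷ []) ⟩
  N p + 10 ^ length (reverse p) * (a + 10 * 0) ≡⟨ cong (λ l → N p + 10 ^ l * (a + 0)) (length-reverse p) ⟩
  N p + 10 ^ length p * (a + 0)                ≡⟨ solve 3 (λ n t a → n :+ t :* (a :+ con 0) := a :* t :+ n) refl (N p) (10 ^ length p) a ⟩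
  a * 10 ^ length p + N p                      ∎

length-⊕ : ∀ u v → length (u ⊕ v) ≡ length u ⊔ length v
length-⊕ []      v       = refl
length-⊕ (a ∷ u) []      = sym (⊔-identityʳ (suc (length u)))
length-⊕ (a ∷ u) (b ∷ v) = cong suc (length-⊕ u v)

-- Sums align the lists at their low ends, so when v is k entries longer than
-- u, the digits of u stand k places higher than those of v.
N-⊕ : ∀ u v k → length v ≡ length u + k → N (u ⊕ v) ≡ N u * 10 ^ k + N v
N-⊕ []      v       k _ = refl
N-⊕ (a ∷ u) []      k ()
N-⊕ (a ∷ u) (b ∷ v) k |v|≡ = begin
  N ((a + b) ∷ (u ⊕ v))                                ≡⟨ N-cons (a + b) (u ⊕ v) ⟩
  (a + b) * 10 ^ length (u ⊕ v) + N (u ⊕ v)            ≡⟨ cong₂ (λ l z → (a + b) * 10 ^ l + z) |u⊕v|≡ (N-⊕ u v k |v|≡′) ⟩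
  (a + b) * 10 ^ (length u + k) + (N u * 10 ^ k + N v) ≡⟨ cong (λ t → (a + b) * t + (N u * 10 ^ k + N v)) (^-distribˡ-+-* 10 (length u) k) ⟩
  (a + b) * (U * K) + (N u * K + N v)                  ≡⟨ solve 6 (λ a b U K n m → (a :+ b) :* (U :* K) :+ (n :* K :+ m)
                                                                               := (a :* U :+ n) :* K :+ (b :* (U :* K) :+ m))
                                                                refl a b U K (N u) (N v) ⟩
  (a * U + N u) * K + (b * (U * K) + N v)              ≡⟨ cong₂ (λ x t → x * K + (b * t + N v)) (sym (N-cons a u)) (sym 10^|v|) ⟩
  N (a ∷ u) * K + (b * 10 ^ length v + N v)            ≡⟨ cong (N (a ∷ u) * K +_) (sym (N-cons b v)) ⟩
  N (a ∷ u) * K + N (b ∷ v)                            ∎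
  where
  U K : ℕ
  U = 10 ^ length u
  K = 10 ^ k
  |v|≡′ : length v ≡ length u + k
  |v|≡′ = suc-injective |v|≡
  |u⊕v|≡ : length (u ⊕ v) ≡ length u + k
  |u⊕v|≡ = trans (length-⊕ u v) (trans (cong (length u ⊔_) |v|≡′) (m≤n⇒m⊔n≡n (m≤m+n (length u) k)))
  10^|v| : 10 ^ length v ≡ U * K
  10^|v| = trans (cong (10 ^_) |v|≡′) (^-distribˡ-+-* 10 (length u) k)

N-map : ∀ a xs → N (map (a *_) xs) ≡ a * N xs
N-map a xs = trans (cong fromDigits (sym (reverse-map (a *_) xs))) (fromDigits-map (reverse xs))
  where
  fromDigits-map : ∀ ys → fromDigits (map (a *_) ys) ≡ a * fromDigits ys
  fromDigits-map []       = sym (*-zeroʳ a)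
  fromDigits-map (y ∷ ys) rewrite fromDigits-map ys =
    solve 3 (λ a y f → a :* y :+ con 10 :* (a :* f) := a :* (y :+ con 10 :* f)) refl a y (fromDigits ys)

length-⊛ : ∀ a p b q → length ((a ∷ p) ⊛ (b ∷ q)) ≡ length p + suc (length q)
length-⊛ a [] b q = begin
  length (map (a *_) (b ∷ q) ⊕ (0 ∷ [])) ≡⟨ length-⊕ (map (a *_) (b ∷ q)) (0 ∷ []) ⟩
  length (map (a *_) (b ∷ q)) ⊔ 1        ≡⟨ cong (_⊔ 1) (length-map (a *_) (b ∷ q)) ⟩
  suc (length q) ⊔ 1                     ≡⟨ m≥n⇒m⊔n≡m (s≤s z≤n) ⟩
  suc (length q)                         ∎
length-⊛ a (a′ ∷ p) b q = begin
  length (map (a *_) (b ∷ q) ⊕ (0 ∷ ((a′ ∷ p) ⊛ (b ∷ q))))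
    ≡⟨ length-⊕ (map (a *_) (b ∷ q)) (0 ∷ ((a′ ∷ p) ⊛ (b ∷ q))) ⟩
  length (map (a *_) (b ∷ q)) ⊔ suc (length ((a′ ∷ p) ⊛ (b ∷ q)))
    ≡⟨ cong₂ (λ x y → x ⊔ suc y) (length-map (a *_) (b ∷ q)) (length-⊛ a′ p b q) ⟩
  suc (length q) ⊔ suc (length p + suc (length q))
    ≡⟨ m≤n⇒m⊔n≡n (m≤n+m (suc (length q)) (suc (length p))) ⟩
  suc (length p + suc (length q)) ∎

N-⊛ : ∀ a p b q → N ((a ∷ p) ⊛ (b ∷ q)) ≡ N (a ∷ p) * N (b ∷ q)
N-⊛ a [] b q = begin
  N ((a * b + 0) ∷ (map (a *_) q ⊕ [])) ≡⟨ cong (λ z → N ((a * b + 0) ∷ z)) (⊕-identityʳ (map (a *_) q)) ⟩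
  N ((a * b + 0) ∷ map (a *_) q)        ≡⟨ cong (λ z → N (z ∷ map (a *_) q)) (+-identityʳ (a * b)) ⟩
  N (map (a *_) (b ∷ q))                ≡⟨ N-map a (b ∷ q) ⟩
  a * N (b ∷ q)                         ≡⟨ cong (_* N (b ∷ q)) (sym N[a]≡a) ⟩
  N (a ∷ []) * N (b ∷ q)                ∎
  where
  ⊕-identityʳ : ∀ u → u ⊕ [] ≡ u
  ⊕-identityʳ []      = refl
  ⊕-identityʳ (_ ∷ _) = refl
  N[a]≡a : N (a ∷ []) ≡ a
  N[a]≡a = trans (N-cons a []) (solve 1 (λ a → a :* con 1 :+ con 0 := a) refl a)
N-⊛ a (a′ ∷ p) b q = begin
  N (map (a *_) (b ∷ q) ⊕ (0 ∷ Rest))         ≡⟨ N-⊕ (map (a *_) (b ∷ q)) (0 ∷ Rest) (length (a′ ∷ p)) |0∷Rest|≡ ⟩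
  N (map (a *_) (b ∷ q)) * L + N (0 ∷ Rest)   ≡⟨ cong₂ (λ x y → x * L + y) (N-map a (b ∷ q)) (N-cons 0 Rest) ⟩
  a * Q * L + (0 + N Rest)                    ≡⟨ cong (a * Q * L +_) (N-⊛ a′ p b q) ⟩
  a * Q * L + N (a′ ∷ p) * Q                  ≡⟨ solve 4 (λ a q l t → a :* q :* l :+ t :* q := (a :* l :+ t) :* q) refl a Q L (N (a′ ∷ p)) ⟩
  (a * L + N (a′ ∷ p)) * Q                    ≡⟨ cong (_* Q) (sym (N-cons a (a′ ∷ p))) ⟩
  N (a ∷ a′ ∷ p) * Q                          ∎
  where
  Rest : List ℕ
  Rest = (a′ ∷ p) ⊛ (b ∷ q)
  L Q : ℕ
  L = 10 ^ length (a′ ∷ p)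
  Q = N (b ∷ q)
  |0∷Rest|≡ : length (0 ∷ Rest) ≡ length (map (a *_) (b ∷ q)) + length (a′ ∷ p)
  |0∷Rest|≡ = begin
    suc (length Rest)                        ≡⟨ cong suc (length-⊛ a′ p b q) ⟩
    suc (length p + suc (length q))          ≡⟨ cong suc (+-comm (length p) (suc (length q))) ⟩
    suc (suc (length q) + length p)          ≡⟨ sym (+-suc (suc (length q)) (length p)) ⟩
    suc (length q) + length (a′ ∷ p)         ≡⟨ cong (_+ length (a′ ∷ p)) (sym (length-map (a *_) (b ∷ q))) ⟩
    length (map (a *_) (b ∷ q)) + length (a′ ∷ p) ∎

-- Proposition 15.  P A is nonempty for A > 0, so N-⊛ applies to P A ⊛ P A.
proposition15 : (A : ℕ) → A > 0 → Palindrome A → PolynomialPair A A → Palindrome (A * A)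
proposition15 A@(suc n) _ A≡revA polyPair = sym (begin
  rev (A * A)      ≡⟨ cong N (sym polyPair) ⟩
  N (P A ⊛ P A)    ≡⟨ N-⊛ d ds d ds ⟩
  rev A * rev A    ≡⟨ cong₂ _*_ (sym A≡revA) (sym A≡revA) ⟩
  A * A            ∎)
  where
  -- P (suc n) unfolds to its least significant digit followed by the rest.
  d : ℕ
  d = A % 10
  ds : List ℕ
  ds = digitsAux n (A / 10)
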